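{- For a real number $x:\mathbb{R}_D$, locators and signed-digit representations are interdefinable: there are functions $\operatorname{locator}(x)\to\operatorname{SDR}(x)$ and $\operatorname{SDR}(x)\to\operatorname{locator}(x)$, where $\operatorname{SDR}(x)$ is the type of signed-digit representations of $x$.
   Context: Work in Martin-Löf type theory with propositional truncation, function extensionality and propositional extensionality. A Dedekind real is a pair $x=(L,U)$ of proposition-valued predicates on $\mathbb{Q}$, writing $q<x$ for $q\in L$ and $x<r$ for $r\in U$, which is bounded, rounded, transitive and located ($q<r\Rightarrow\|(q<x)+(x<r)\|$). $\mathbb{R}_D$ is the type of Dedekind reals. A locator for $x$ is a function $\prod_{q,r:\mathbb{Q}}(q<r)\to(q<x)+(x<r)$ into the untruncated disjoint sum; $\operatorname{locator}(x)$ is the type of locators. A signed-digit representation of $x$ consists of $k:\mathbb{Z}$ and a sequence $a:\mathbb{N}\to\{ -9,-8,\dots,-1,0,1,\dots,9\}$ such that $x=k+\sum_{i=0}^\infty a_i\cdot 10^{ -i-1}$; $\operatorname{SDR}(x)$ is the type of such pairs $(k,a)$ together with a proof of this equation. -}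

module Defs where

open import Level using (Level; _⊔_; Setω) renaming (suc to lsuc; zero to lzero)
open import Data.Nat using (ℕ; zero; suc)
import Data.Nat as ℕ
open import Data.Integer using (ℤ; +_) renaming (∣_∣ to absℤ)
open import Data.Rational using (ℚ; _<_; _+_; _-_; _*_; _/_; 0ℚ; 1ℚ)
open import Data.Product using (Σ; Σ-syntax; _×_; _,_)
open import Data.Sum using (_⊎_)
open import Function.Bundles using (_⇔_)
open import Relation.Binary.PropositionalEquality using (_≡_)

isProp : ∀ {a} → Set a → Set a
isProp A = (x y : A) → x ≡ y

record Truncation : Set₁ where
  field
    ∥_∥    : Set → Set
    ∣_∣ₜ   : {A : Set} → A → ∥ A ∥
    squash : {A : Set} → isProp ∥ A ∥
    rec    : {A B : Set} → isProp B → (A → B) → ∥ A ∥ → B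

FunExt : Setω
FunExt = ∀ {a b} {A : Set a} {B : A → Set b} {f g : (x : A) → B x}
         → ((x : A) → f x ≡ g x) → f ≡ g

PropExt : Set₁
PropExt = {A B : Set} → isProp A → isProp B → (A → B) → (B → A) → A ≡ B

module _ (T : Truncation) where
  open Truncation T

  -- Dedekind reals (HoTT book, Def. 11.2.1).
  record ℝD : Set₁ where
    field
      L U        : ℚ → Set
      L-prop     : ∀ q → isProp (L q)
      U-prop     : ∀ r → isProp (U r)
      bounded-L  : ∥ Σ ℚ L ∥
      bounded-U  : ∥ Σ ℚ U ∥
      rounded-L  : ∀ q → L q ⇔ ∥ Σ[ r ∈ ℚ ] (q < r × L r) ∥
      rounded-U  : ∀ r → U r ⇔ ∥ Σ[ q ∈ ℚ ] (q < r × U q) ∥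
      transitive : ∀ q r → L q → U r → q < r
      located    : ∀ q r → q < r → ∥ L q ⊎ U r ∥

  open ℝD public

  _<ᴸ_ : ℚ → ℝD → Set
  q <ᴸ x = L x q

  _<ᵁ_ : ℝD → ℚ → Set
  x <ᵁ r = U x r

  locator : ℝD → Set
  locator x = (q r : ℚ) → q < r → (q <ᴸ x) ⊎ (x <ᵁ r)

  Digit : Set
  Digit = Σ[ d ∈ ℤ ] (absℤ d ℕ.≤ 9)

  tenthPow : ℕ → ℚ
  tenthPow zero    = 1ℚ
  tenthPow (suc n) = tenthPow n * (+ 1 / 10)

  approx : ℤ → (ℕ → Digit) → ℕ → ℚ
  approx k a zero    = k / 1
  approx k a (suc n) = approx k a n + ((proj₁ (a n) / 1) * tenthPow (suc n))
    where open import Data.Product using (proj₁)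

  -- The real number k + Σ_{i≥0} a_i·10^{-i-1}, given by its cuts:
  -- since |Σ_{i≥n} a_i·10^{-i-1}| ≤ 10^{-n}, the value y satisfies
  --   q < y  iff  ∃ n. q < approx n - 10^{-n}
  --   y < r  iff  ∃ n. approx n + 10^{-n} < r
  seriesL : ℤ → (ℕ → Digit) → ℚ → Set
  seriesL k a q = ∥ Σ[ n ∈ ℕ ] (q < approx k a n - tenthPow n) ∥

  seriesU : ℤ → (ℕ → Digit) → ℚ → Set
  seriesU k a r = ∥ Σ[ n ∈ ℕ ] (approx k a n + tenthPow n < r) ∥

  -- x = k + Σ_{i≥0} a_i·10^{-i-1}  (equality of Dedekind reals = equality of cuts)
  Represents : ℝD → ℤ → (ℕ → Digit) → Set
  Represents x k a = (∀ q → (q <ᴸ x) ⇔ seriesL k a q) × (∀ r → (x <ᵁ r) ⇔ seriesU k a r)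

  SDR : ℝD → Set
  SDR x = Σ[ k ∈ ℤ ] Σ[ a ∈ (ℕ → Digit) ] Represents x k a

{-# OPTIONS --safe #-}
-- A signed-digit representation gives a locator: to decide q < r, compare q with a
-- partial sum whose error 10⁻ⁿ is less than (r - q)/2.
-- Conversely, a locator lets us trap x digit by digit. If x lies within ε of c, querying
-- the locator along the grid c - ε + iε/10 (i = 0, ..., 20) from the left finds a digit
-- d ∈ {-9, ..., 9} with x within ε/10 of c + dε/10. The integer part is found the same
-- way between integer bounds. Those bounds exist only under truncation, but the least n
-- for which the locator answers the n-th bound query favourably is unique, so by function
-- extensionality it can be taken out of the truncation.
module Submission where

open import Defs
open import Data.Rational.Properties
open import Algebra.Properties.Group +-0-group using (⁻¹-involutive)
import Data.Bool as Bool
open import Data.Bool.Properties using (T-irrelevant)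
open import Data.Empty using (⊥-elim)
open import Data.Integer as ℤ using (ℤ; +_; -[1+_]; _⊖_)
import Data.Integer.Properties as ℤP
open import Data.List using (_∷_; [])
open import Data.Maybe using (is-just; to-witness-T)
open import Data.Nat as ℕ using (ℕ; zero; suc; z≤n; s≤s)
import Data.Nat.Properties as ℕP
open import Data.Product using (Σ; Σ-syntax; _×_; _,_; proj₁; proj₂; map₂)
open import Data.Rational
  using (ℚ; mkℚ; _/_; _+_; _-_; _*_; -_; 1/_; _<_; _≤_; *<*; *≤*; 0ℚ; 1ℚ)
open import Data.Rational using (Positive; NonZero; positive; nonNegative; >-nonZero)
open import Data.Rational.Literals using (fromℤ)
open import Data.Sum using (_⊎_; inj₁; inj₂; [_,_]′; isInj₁; swap)
open import Data.Unit using (tt)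
open import Function using (_∘_)
open import Function.Bundles using (mk⇔; Equivalence)
open import Level using (0ℓ)
open import Relation.Binary.Definitions using (tri<; tri≈; tri>)
open import Relation.Binary.PropositionalEquality
open import Relation.Nullary using (Dec; yes; no; ¬_)
open import Relation.Nullary.Decidable using (dec⇒maybe; toWitness; T?)
open import Relation.Unary using (Decidable)
open import Tactic.RingSolver using (solve)
open import Tactic.RingSolver.Core.AlmostCommutativeRing using (AlmostCommutativeRing; fromCommutativeRing)

ℚ-ring : AlmostCommutativeRing 0ℓ 0ℓ
ℚ-ring = fromCommutativeRing +-*-commutativeRing (λ p → dec⇒maybe (0ℚ ≟ p))

∣j⊖9∣≤9 : ∀ {j} → j ℕ.≤ 18 → ℤ.∣ j ⊖ 9 ∣ ℕ.≤ 9
∣j⊖9∣≤9 {j} j≤18 with ℕP.≤-total j 9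
... | inj₁ j≤9 = subst (ℕ._≤ 9) (sym (ℤP.∣⊖∣-≤ j≤9)) (ℕP.m∸n≤m 9 j)
... | inj₂ 9≤j = subst (ℕ._≤ 9) (sym (trans (ℤP.∣m⊖n∣≡∣n⊖m∣ j 9) (ℤP.∣⊖∣-≤ 9≤j)))
                       (ℕP.∸-monoˡ-≤ 9 j≤18)

n<10^n : ∀ n → n ℕ.< 10 ℕ.^ n
n<10^n zero    = s≤s z≤n
n<10^n (suc n) = ℕP.+-mono-≤ (ℕP.m^n>0 10 n) (ℕP.≤-trans (n<10^n n) (ℕP.m≤n*m (10 ℕ.^ n) 9))

IsLeast : (ℕ → Set) → ℕ → Set
IsLeast P n = P n × (∀ m → m ℕ.< n → ¬ P m)

least-below : ∀ {P} → Decidable P → ∀ N → (∀ m → m ℕ.< N → ¬ P m) ⊎ Σ ℕ (IsLeast P)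
least-below P? zero = inj₁ λ _ ()
least-below P? (suc N) with least-below P? N
... | inj₂ l    = inj₂ l
... | inj₁ none with P? N
...   | yes PN  = inj₂ (N , PN , none)
...   | no  ¬PN = inj₁ λ m m<1+N → [ none m , (λ { refl → ¬PN }) ]′ (ℕP.m<1+n⇒m<n∨m≡n m<1+N)

least : ∀ {P} → Decidable P → Σ ℕ P → Σ ℕ (IsLeast P)
least P? (N , PN) with least-below P? (suc N)
... | inj₁ none = ⊥-elim (none N (ℕP.n<1+n N) PN)
... | inj₂ l    = l

least-isProp : FunExt → ∀ {P} → (∀ n → isProp (P n)) → isProp (Σ ℕ (IsLeast P))
least-isProp fe P-prop (m , Pm , m-least) (n , Pn , n-least) with ℕP.<-cmp m n
... | tri< m<n _ _  = ⊥-elim (n-least m m<n Pm)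
... | tri> _ _ n<m  = ⊥-elim (m-least n n<m Pn)
... | tri≈ _ refl _ = cong₂ (λ Pm′ least′ → m , Pm′ , least′) (P-prop m Pm Pn)
                        (fe λ k → fe λ k<m → fe λ Pk → ⊥-elim (m-least k k<m Pk))

¬B⇒isInj₁ : ∀ {A B : Set} (s : A ⊎ B) → ¬ B → Bool.T (is-just (isInj₁ s))
¬B⇒isInj₁ (inj₁ _) _  = tt
¬B⇒isInj₁ (inj₂ b) ¬b = ¬b b

/1≡fromℤ : ∀ i → i / 1 ≡ fromℤ i
/1≡fromℤ i = ↥p/↧p≡p (fromℤ i)

/1-homo-+ : ∀ i j → (i ℤ.+ j) / 1 ≡ i / 1 + j / 1
/1-homo-+ i j = begin
  (i ℤ.+ j) / 1                  ≡⟨ sym (cong₂ (λ m n → (m ℤ.+ n) / 1) (ℤP.*-identityʳ i) (ℤP.*-identityʳ j)) ⟩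
  (i ℤ.* + 1 ℤ.+ j ℤ.* + 1) / 1  ≡⟨⟩
  fromℤ i + fromℤ j              ≡⟨ sym (cong₂ _+_ (/1≡fromℤ i) (/1≡fromℤ j)) ⟩
  i / 1 + j / 1                  ∎
  where open ≡-Reasoning

/1-homo-* : ∀ m n → + (m ℕ.* n) / 1 ≡ (+ m / 1) * (+ n / 1)
/1-homo-* m n = begin
  + (m ℕ.* n) / 1      ≡⟨ cong (_/ 1) (ℤP.pos-* m n) ⟩
  (+ m ℤ.* + n) / 1    ≡⟨⟩
  fromℤ (+ m) * fromℤ (+ n) ≡⟨ sym (cong₂ _*_ (/1≡fromℤ (+ m)) (/1≡fromℤ (+ n))) ⟩
  (+ m / 1) * (+ n / 1) ∎
  where open ≡-Reasoning

/1-mono-< : ∀ {i j} → i ℤ.< j → i / 1 < j / 1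
/1-mono-< {i} {j} i<j = subst₂ _<_ (sym (/1≡fromℤ i)) (sym (/1≡fromℤ j))
  (*<* (subst₂ ℤ._<_ (sym (ℤP.*-identityʳ i)) (sym (ℤP.*-identityʳ j)) i<j))

/1-mono-≤ : ∀ {i j} → i ℤ.≤ j → i / 1 ≤ j / 1
/1-mono-≤ {i} {j} i≤j = subst₂ _≤_ (sym (/1≡fromℤ i)) (sym (/1≡fromℤ j))
  (*≤* (subst₂ ℤ._≤_ (sym (ℤP.*-identityʳ i)) (sym (ℤP.*-identityʳ j)) i≤j))

p<q⇒0<q-p : ∀ {p q} → p < q → 0ℚ < q - p
p<q⇒0<q-p {p} {q} p<q = subst (_< q - p) (+-inverseʳ p) (+-monoˡ-< (- p) p<q)

p<p+h : ∀ p {h} → 0ℚ < h → p < p + h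
p<p+h p {h} 0<h = subst (_< p + h) (+-identityʳ p) (+-monoʳ-< p 0<h)

archimedean : ∀ q → Σ[ N ∈ ℕ ] q < + N / 1
archimedean q@(mkℚ n d _) = N , subst (q <_) (sym (/1≡fromℤ (+ N))) (*<* n*1<N*[1+d])
  where
  N = suc ℤ.∣ n ∣
  n≤+∣n∣ : ∀ n → n ℤ.≤ + ℤ.∣ n ∣
  n≤+∣n∣ (+ _)    = ℤP.≤-refl
  n≤+∣n∣ -[1+ _ ] = ℤ.-≤+
  n*1<N*[1+d] : n ℤ.* + 1 ℤ.< + N ℤ.* + suc d
  n*1<N*[1+d] = subst₂ ℤ._<_ (sym (ℤP.*-identityʳ n)) (ℤP.pos-* N (suc d))
    (ℤP.≤-<-trans (n≤+∣n∣ n) (ℤ.+<+ (ℕP.<-≤-trans (ℕP.n<1+n _) (ℕP.m≤m*n N (suc d)))))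

short-interval-below : ∀ {c t q r} → t + t < r - q → c - t ≤ q → c + t < r
short-interval-below {c} {t} {q} {r} 2t<r-q c-t≤q = begin-strict
  c + t             ≡⟨ solve (c ∷ t ∷ []) ℚ-ring ⟩
  (c - t) + (t + t) ≤⟨ +-monoˡ-≤ (t + t) c-t≤q ⟩
  q + (t + t)       <⟨ +-monoʳ-< q 2t<r-q ⟩
  q + (r - q)       ≡⟨ solve (q ∷ r ∷ []) ℚ-ring ⟩
  r                 ∎
  where open ≤-Reasoning

short-interval-above : ∀ {c t q r} → t + t < r - q → r ≤ c + t → q < c - t
short-interval-above {c} {t} {q} {r} 2t<r-q r≤c+t = begin-strict
  q                     ≡⟨ solve (q ∷ r ∷ []) ℚ-ring ⟩
  r + - (r - q)         <⟨ +-mono-≤-< r≤c+t (neg-antimono-< 2t<r-q) ⟩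
  (c + t) + - (t + t)   ≡⟨ solve (c ∷ t ∷ []) ℚ-ring ⟩
  c - t                 ∎
  where open ≤-Reasoning

progression : ℚ → ℚ → ℕ → ℚ
progression b h i = b + + i / 1 * h

progression-suc : ∀ b h i → progression b h (suc i) ≡ progression b h i + h
progression-suc b h i = begin
  b + + suc i / 1 * h          ≡⟨ cong (λ s → b + s * h) (/1-homo-+ (+ 1) (+ i)) ⟩
  b + (+ 1 / 1 + + i / 1) * h  ≡⟨ step (+ i / 1) ⟩
  b + + i / 1 * h + h          ∎
  where
  open ≡-Reasoning
  step : ∀ I → b + (+ 1 / 1 + I) * h ≡ b + I * h + h
  step I = solve (b ∷ h ∷ I ∷ []) ℚ-ring

progression-zero : ∀ b h → b ≡ progression b h 0
progression-zero b h = sym (trans (cong (_+_ b) (*-zeroˡ h)) (+-identityʳ b))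

progression-pred : ∀ b h i → progression b h i ≡ progression b h (suc i) - h
progression-pred b h i = begin
  progression b h i            ≡⟨ p≡p+h-h (progression b h i) ⟩
  progression b h i + h - h    ≡⟨ cong (_- h) (sym (progression-suc b h i)) ⟩
  progression b h (suc i) - h  ∎
  where
  open ≡-Reasoning
  p≡p+h-h : ∀ p → p ≡ p + h - h
  p≡p+h-h p = solve (p ∷ h ∷ []) ℚ-ring

progression-increasing : ∀ {b h} → 0ℚ < h → ∀ i → progression b h i < progression b h (suc i)
progression-increasing {b} {h} 0<h i =
  subst (progression b h i <_) (sym (progression-suc b h i)) (p<p+h _ 0<h)

module _ (T : Truncation) where
  open Truncation T

  tenthPow-pos : ∀ n → Positive (tenthPow T n)
  tenthPow-pos zero    = _
  tenthPow-pos (suc n) = pos*pos⇒pos (tenthPow T n) {{tenthPow-pos n}} (+ 1 / 10)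

  0<tenthPow : ∀ n → 0ℚ < tenthPow T n
  0<tenthPow n = positive⁻¹ (tenthPow T n) {{tenthPow-pos n}}

  tenthPow*10^n≡1 : ∀ n → tenthPow T n * (+ (10 ℕ.^ n) / 1) ≡ 1ℚ
  tenthPow*10^n≡1 zero    = refl
  tenthPow*10^n≡1 (suc n) = begin
    tenthPow T n * (+ 1 / 10) * (+ (10 ℕ.* 10 ℕ.^ n) / 1)
      ≡⟨ cong (tenthPow T n * (+ 1 / 10) *_) (/1-homo-* 10 (10 ℕ.^ n)) ⟩
    tenthPow T n * (+ 1 / 10) * ((+ 10 / 1) * (+ (10 ℕ.^ n) / 1))
      ≡⟨ cancel (tenthPow T n) (+ (10 ℕ.^ n) / 1) ⟩
    tenthPow T n * (+ (10 ℕ.^ n) / 1)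
      ≡⟨ tenthPow*10^n≡1 n ⟩
    1ℚ ∎
    where
    open ≡-Reasoning
    cancel : ∀ t X → t * (+ 1 / 10) * ((+ 10 / 1) * X) ≡ t * X
    cancel t X = solve (t ∷ X ∷ []) ℚ-ring

  tenthPow<ε : ∀ ε → 0ℚ < ε → Σ[ n ∈ ℕ ] tenthPow T n < ε
  tenthPow<ε ε 0<ε = N , *-cancelʳ-<-nonNeg X {{nonNegative (<⇒≤ 0<X)}} t*X<ε*X
    where
    instance
      ε-nonZero : NonZero ε
      ε-nonZero = >-nonZero 0<ε
      ε-positive : Positive ε
      ε-positive = positive 0<ε
    N = proj₁ (archimedean (1/ ε))
    X = + (10 ℕ.^ N) / 1
    0<X : 0ℚ < X
    0<X = /1-mono-< (ℤ.+<+ (ℕP.m^n>0 10 N))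
    1/ε<X : 1/ ε < X
    1/ε<X = <-≤-trans (proj₂ (archimedean (1/ ε))) (/1-mono-≤ (ℤ.+≤+ (ℕP.<⇒≤ (n<10^n N))))
    t*X<ε*X : tenthPow T N * X < ε * X
    t*X<ε*X = subst (_< ε * X) (trans (*-inverseʳ ε) (sym (tenthPow*10^n≡1 N))) (*-monoʳ-<-pos ε 1/ε<X)

  tenthPow-vanishes : ∀ ε → 0ℚ < ε → Σ[ n ∈ ℕ ] tenthPow T n + tenthPow T n < ε
  tenthPow-vanishes ε 0<ε with tenthPow<ε ε 0<ε
  ... | n , tₙ<ε = suc n , <-trans 2tₙ₊₁<tₙ tₙ<ε
    where
    2tₙ₊₁<tₙ : tenthPow T (suc n) + tenthPow T (suc n) < tenthPow T n
    2tₙ₊₁<tₙ = subst₂ _<_ (double (tenthPow T n)) (*-identityʳ (tenthPow T n))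
      (*-monoʳ-<-pos (tenthPow T n) {{tenthPow-pos n}} (toWitness {a? = + 2 / 10 <? 1ℚ} _))
      where
      double : ∀ t → t * (+ 2 / 10) ≡ t * (+ 1 / 10) + t * (+ 1 / 10)
      double t = solve (t ∷ []) ℚ-ring

  ∥Σℕ∥⇒Σℕ : FunExt → ∀ {P} → (∀ n → isProp (P n)) → Decidable P → ∥ Σ ℕ P ∥ → Σ ℕ P
  ∥Σℕ∥⇒Σℕ fe P-prop P? = map₂ proj₁ ∘ rec (least-isProp fe P-prop) (least P?)

  inj₁-search : FunExt → {A B : ℕ → Set} (s : ∀ n → A n ⊎ B n)
              → ∥ Σ[ n ∈ ℕ ] ¬ B n ∥ → Σ[ n ∈ ℕ ] A n
  inj₁-search fe s ∃¬B = map₂ (λ {n} → to-witness-T (isInj₁ (s n)))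
    (∥Σℕ∥⇒Σℕ fe (λ _ → T-irrelevant) (λ n → T? _)
      (rec squash (λ (n , ¬Bₙ) → ∣ n , ¬B⇒isInj₁ (s n) ¬Bₙ ∣ₜ) ∃¬B))

  module _ (x : ℝD T) where

    InBall : ℚ → ℚ → Set
    InBall c ε = L x (c - ε) × U x (c + ε)

    L-downward : ∀ {q r} → q < r → L x r → L x q
    L-downward {q} {r} q<r Lr = Equivalence.from (rounded-L x q) ∣ r , q<r , Lr ∣ₜ

    U-upward : ∀ {q r} → q < r → U x q → U x r
    U-upward {q} {r} q<r Uq = Equivalence.from (rounded-U x r) ∣ q , q<r , Uq ∣ₜ

    represents⇒locator : ∀ {k a} → Represents T x k a → locator T x
    represents⇒locator {k} {a} (L⇔ , U⇔) q r q<r = choose (q <? approx T k a n - tenthPow T n)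
      where
      small = tenthPow-vanishes (r - q) (p<q⇒0<q-p {q} {r} q<r)
      n = proj₁ small
      2t<r-q = proj₂ small
      choose : Dec (q < approx T k a n - tenthPow T n) → L x q ⊎ U x r
      choose (yes q<c-t) = inj₁ (Equivalence.from (L⇔ q) ∣ n , q<c-t ∣ₜ)
      choose (no  q≮c-t) = inj₂ (Equivalence.from (U⇔ r) ∣ n , c+t<r ∣ₜ)
        where
        c+t<r : approx T k a n + tenthPow T n < r
        c+t<r = short-interval-below {approx T k a n} {tenthPow T n} 2t<r-q (≮⇒≥ q≮c-t)

    balls⇒represents : ∀ {k a} → (∀ n → InBall (approx T k a n) (tenthPow T n)) → Represents T x k a
    balls⇒represents {k} {a} ball =
      (λ q → mk⇔ (λ Lq → rec squash below (Equivalence.to (rounded-L x q) Lq))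
                 (rec (L-prop x q) λ (n , q<c-t) → L-downward q<c-t (proj₁ (ball n)))) ,
      (λ r → mk⇔ (λ Ur → rec squash above (Equivalence.to (rounded-U x r) Ur))
                 (rec (U-prop x r) λ (n , c+t<r) → U-upward c+t<r (proj₂ (ball n))))
      where
      below : ∀ {q} → Σ[ r ∈ ℚ ] q < r × L x r → seriesL T k a q
      below {q} (r , q<r , Lr) =
        let n , 2t<r-q = tenthPow-vanishes (r - q) (p<q⇒0<q-p {q} {r} q<r)
        in ∣ n , short-interval-above {approx T k a n} {tenthPow T n} 2t<r-q
                   (<⇒≤ (transitive x r _ Lr (proj₂ (ball n)))) ∣ₜ
      above : ∀ {r} → Σ[ q ∈ ℚ ] q < r × U x q → seriesU T k a r
      above {r} (q , q<r , Uq) =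
        let n , 2t<r-q = tenthPow-vanishes (r - q) (p<q⇒0<q-p {q} {r} q<r)
        in ∣ n , short-interval-below {approx T k a n} {tenthPow T n} 2t<r-q
                   (<⇒≤ (transitive x _ q (proj₁ (ball n)) Uq)) ∣ₜ

    module _ (ℓ : locator T x) where

      locate : (p : ℕ → ℚ) → (∀ i → p i < p (suc i)) → ∀ m → L x (p 0) → U x (p (2 ℕ.+ m))
             → Σ[ j ∈ ℕ ] j ℕ.≤ m × L x (p j) × U x (p (2 ℕ.+ j))
      locate p p↑ zero    Lp₀ Up₂₊ₘ = 0 , z≤n , Lp₀ , Up₂₊ₘ
      locate p p↑ (suc m) Lp₀ Up₂₊ₘ with ℓ (p 1) (p 2) (p↑ 1)
      ... | inj₂ Up₂ = 0 , z≤n , Lp₀ , Up₂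
      ... | inj₁ Lp₁ with locate (p ∘ suc) (p↑ ∘ suc) m Lp₁ Up₂₊ₘ
      ...   | j , j≤m , Lpⱼ₊₁ , Upⱼ₊₃ = suc j , s≤s j≤m , Lpⱼ₊₁ , Upⱼ₊₃

      locate-progression : ∀ {b h} → 0ℚ < h → ∀ m → L x b → U x (progression b h (2 ℕ.+ m))
                         → Σ[ j ∈ ℕ ] j ℕ.≤ m × InBall (progression b h (suc j)) h
      locate-progression {b} {h} 0<h m Lb Uend =
        ball (locate (progression b h) (progression-increasing {b} 0<h) m Lp₀ Uend)
        where
        Lp₀ : L x (progression b h 0)
        Lp₀ = subst (L x) (progression-zero b h) Lb
        ball : Σ[ j ∈ ℕ ] j ℕ.≤ m × L x (progression b h j) × U x (progression b h (2 ℕ.+ j))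
             → Σ[ j ∈ ℕ ] j ℕ.≤ m × InBall (progression b h (suc j)) h
        ball (j , j≤m , Lpⱼ , Upⱼ₊₂) =
          j , j≤m , subst (L x) (progression-pred b h j) Lpⱼ , subst (U x) (progression-suc b h (suc j)) Upⱼ₊₂

      refine : ∀ c {ε} → 0ℚ < ε → InBall c ε
             → Σ[ d ∈ Digit T ] InBall (c + proj₁ d / 1 * (ε * (+ 1 / 10))) (ε * (+ 1 / 10))
      refine c {ε} 0<ε (Lc-ε , Uc+ε) = digit (locate-progression 0<h 18 Lc-ε (subst (U x) end Uc+ε))
        where
        h = ε * (+ 1 / 10)
        0<h : 0ℚ < h
        0<h = positive⁻¹ h {{pos*pos⇒pos ε {{positive 0<ε}} (+ 1 / 10)}}
        end : c + ε ≡ (c - ε) + + 20 / 1 * (ε * (+ 1 / 10))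
        end = solve (c ∷ ε ∷ []) ℚ-ring
        centre : ∀ j → progression (c - ε) h (suc j) ≡ c + (j ⊖ 9) / 1 * h
        centre j = begin
          (c - ε) + + suc j / 1 * h          ≡⟨ cong (λ s → (c - ε) + s * h) (/1-homo-+ (+ 1) (+ j)) ⟩
          (c - ε) + (+ 1 / 1 + + j / 1) * h  ≡⟨ shift (+ j / 1) ⟩
          c + (+ j / 1 + -[1+ 8 ] / 1) * h   ≡⟨ cong (λ s → c + s * h) (sym (/1-homo-+ (+ j) -[1+ 8 ])) ⟩
          c + (j ⊖ 9) / 1 * h                ∎
          where
          open ≡-Reasoning
          shift : ∀ J → (c - ε) + (+ 1 / 1 + J) * (ε * (+ 1 / 10)) ≡ c + (J + -[1+ 8 ] / 1) * (ε * (+ 1 / 10))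
          shift J = solve (c ∷ ε ∷ J ∷ []) ℚ-ring
        digit : Σ[ j ∈ ℕ ] j ℕ.≤ 18 × InBall (progression (c - ε) h (suc j)) h
              → Σ[ d ∈ Digit T ] InBall (c + proj₁ d / 1 * h) h
        digit (j , j≤18 , ball) = (j ⊖ 9 , ∣j⊖9∣≤9 j≤18) , subst (λ c′ → InBall c′ h) (centre j) ball

      module _ (fe : FunExt) where

        lower-bound : Σ[ a ∈ ℕ ] L x (- (+ suc a / 1))
        lower-bound = inj₁-search fe query (rec squash witness (bounded-L x))
          where
          query : ∀ n → L x (- (+ suc n / 1)) ⊎ U x (- (+ n / 1))
          query n = ℓ _ _ (neg-antimono-< (/1-mono-< (ℤ.+<+ (ℕP.n<1+n n))))
          witness : Σ ℚ (L x) → ∥ Σ[ n ∈ ℕ ] ¬ U x (- (+ n / 1)) ∥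
          witness (q , Lq) =
            let N , -q<N = archimedean (- q)
                -N<q = subst (- (+ N / 1) <_) (⁻¹-involutive q) (neg-antimono-< -q<N)
            in ∣ N , (λ U-N → <-asym (transitive x q _ Lq U-N) -N<q) ∣ₜ

        upper-bound : Σ[ b ∈ ℕ ] U x (+ suc b / 1)
        upper-bound = inj₁-search fe (swap ∘ query) (rec squash witness (bounded-U x))
          where
          query : ∀ n → L x (+ n / 1) ⊎ U x (+ suc n / 1)
          query n = ℓ _ _ (/1-mono-< (ℤ.+<+ (ℕP.n<1+n n)))
          witness : Σ ℚ (U x) → ∥ Σ[ n ∈ ℕ ] ¬ L x (+ n / 1) ∥
          witness (r , Ur) =
            let N , r<N = archimedean r
            in ∣ N , (λ LN → <-asym (transitive x _ r LN Ur) r<N) ∣ₜ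

        integer-ball : Σ[ k ∈ ℤ ] InBall (k / 1) 1ℚ
        integer-ball =
          centre (locate-progression 0<1 (a ℕ.+ b) (proj₂ lower-bound) (subst (U x) end (proj₂ upper-bound)))
          where
          a = proj₁ lower-bound
          b = proj₁ upper-bound
          0<1 : 0ℚ < 1ℚ
          0<1 = positive⁻¹ 1ℚ
          end : + suc b / 1 ≡ progression (- (+ suc a / 1)) 1ℚ (2 ℕ.+ (a ℕ.+ b))
          end = begin
            + suc b / 1                                     ≡⟨ /1-homo-+ (+ 1) (+ b) ⟩
            + 1 / 1 + + b / 1                               ≡⟨ shift (+ a / 1) (+ b / 1) ⟩
            - (+ 1 / 1 + + a / 1) + (+ 2 / 1 + (+ a / 1 + + b / 1)) * 1ℚ
              ≡⟨ cong₂ (λ s t → - s + t * 1ℚ) (sym (/1-homo-+ (+ 1) (+ a))) (sym 2+a+b) ⟩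
            - (+ suc a / 1) + + (2 ℕ.+ (a ℕ.+ b)) / 1 * 1ℚ  ∎
            where
            open ≡-Reasoning
            shift : ∀ A B → + 1 / 1 + B ≡ - (+ 1 / 1 + A) + (+ 2 / 1 + (A + B)) * 1ℚ
            shift A B = solve (A ∷ B ∷ []) ℚ-ring
            2+a+b : + (2 ℕ.+ (a ℕ.+ b)) / 1 ≡ + 2 / 1 + (+ a / 1 + + b / 1)
            2+a+b = trans (/1-homo-+ (+ 2) (+ (a ℕ.+ b))) (cong (_+_ (+ 2 / 1)) (/1-homo-+ (+ a) (+ b)))
          centre : Σ[ j ∈ ℕ ] j ℕ.≤ a ℕ.+ b × InBall (progression (- (+ suc a / 1)) 1ℚ (suc j)) 1ℚ
                 → Σ[ k ∈ ℤ ] InBall (k / 1) 1ℚ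
          centre (j , _ , ball) = -[1+ a ] ℤ.+ + suc j , subst (λ c → InBall c 1ℚ) centre≡ ball
            where
            -- -[1+ a ] / 1 reduces to - (+ suc a / 1).
            centre≡ : progression (- (+ suc a / 1)) 1ℚ (suc j) ≡ (-[1+ a ] ℤ.+ + suc j) / 1
            centre≡ = trans (cong (_+_ (- (+ suc a / 1))) (*-identityʳ (+ suc j / 1)))
                            (sym (/1-homo-+ -[1+ a ] (+ suc j)))

        centres : ∀ n → Σ[ c ∈ ℚ ] InBall c (tenthPow T n)
        digits : ℕ → Digit T
        digits n = proj₁ (refine (proj₁ (centres n)) (0<tenthPow n) (proj₂ (centres n)))
        centres zero    = proj₁ integer-ball / 1 , proj₂ integer-ball
        centres (suc n) = proj₁ (centres n) + proj₁ (digits n) / 1 * tenthPow T (suc n)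
                        , proj₂ (refine (proj₁ (centres n)) (0<tenthPow n) (proj₂ (centres n)))

        approx≡centre : ∀ n → approx T (proj₁ integer-ball) digits n ≡ proj₁ (centres n)
        approx≡centre zero    = refl
        approx≡centre (suc n) = cong (_+ proj₁ (digits n) / 1 * tenthPow T (suc n)) (approx≡centre n)

        locator⇒sdr : SDR T x
        locator⇒sdr = proj₁ integer-ball , digits , balls⇒represents λ n →
          subst (λ c → InBall c (tenthPow T n)) (sym (approx≡centre n)) (proj₂ (centres n))

theorem3p36 : (T : Truncation) → FunExt → PropExt → (x : ℝD T)
              → (locator T x → SDR T x) × (SDR T x → locator T x)
theorem3p36 T fe _ x = (λ ℓ → locator⇒sdr T x ℓ fe) , λ (_ , _ , rep) → represents⇒locator T x rep
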